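{- For every integer $n\ge 1$ there exists an instance $(G,L)$ of the Stable Matching Problem such that $G$ is a bipartite graph on $2n+2$ vertices that admits a perfect matching, exactly two vertices are unmatched in the unique stable matching of $(G,L)$, and the minimum number of swaps that leads to an instance (on the same graph $G$) with a perfect stable matching is at least $n$.
   Context: An instance of the Stable Matching Problem is a bipartite graph $G=(A,B;E)$ together with a set $L$ of preference lists: for each vertex $v$, a strict ordering $\ell(v)$ of all neighbours of $v$ ($v$ prefers earlier elements). For a matching $M$, an edge $ab\in E\setminus M$ is blocking if ($a$ is unmatched in $M$ or $a$ prefers $b$ to its partner in $M$) and ($b$ is unmatched in $M$ or $b$ prefers $a$ to its partner in $M$). $M$ is stable if it has no blocking edge; a matching is perfect if it covers all vertices. A swap exchanges two consecutive elements of one preference list. -}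

module Defs where

open import Data.Nat using (ℕ; zero; suc; _+_)
open import Data.Fin using (Fin; zero; suc)
open import Data.List using (List; _∷_; [])
open import Data.List.Membership.Propositional using (_∈_)
open import Data.List.Relation.Unary.Unique.Propositional using (Unique)
open import Data.Maybe using (Maybe; just; nothing)
open import Data.Product using (Σ; ∃; _×_; _,_)
open import Data.Sum using (_⊎_)
open import Relation.Nullary using (¬_)
open import Relation.Binary.PropositionalEquality using (_≡_; _≢_)
open import Function.Bundles using (_⇔_)

-- Before x y ℓ : x occurs strictly earlier than y in the list ℓ
-- ("prefers x to y" when ℓ is a preference list).
data Before {A : Set} (x y : A) : List A → Set where
  here  : ∀ {l} → y ∈ l → Before x y (x ∷ l)
  there : ∀ {z l} → Before x y l → Before x y (z ∷ l)

-- The edge set is encoded by the preference lists: ab ∈ E iff b ∈ ℓ(a) iff a ∈ ℓ(b).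
record Instance (na nb : ℕ) : Set where
  field
    prefA : Fin na → List (Fin nb)
    prefB : Fin nb → List (Fin na)
    uniqA : ∀ a → Unique (prefA a)
    uniqB : ∀ b → Unique (prefB b)
    consistent : ∀ a b → (b ∈ prefA a) ⇔ (a ∈ prefB b)

open Instance public

Edge : ∀ {na nb} → Instance na nb → Fin na → Fin nb → Set
Edge I a b = b ∈ prefA I a

record Matching {na nb} (I : Instance na nb) : Set where
  field
    mA : Fin na → Maybe (Fin nb)
    mB : Fin nb → Maybe (Fin na)
    inv : ∀ a b → (mA a ≡ just b) ⇔ (mB b ≡ just a)
    usesEdges : ∀ a b → mA a ≡ just b → Edge I a b

open Matching public

WantsA : ∀ {na nb} {I : Instance na nb} → Matching I → Fin na → Fin nb → Set
WantsA {I = I} M a b = mA M a ≡ nothing ⊎ ∃ λ b' → mA M a ≡ just b' × Before b b' (prefA I a)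

WantsB : ∀ {na nb} {I : Instance na nb} → Matching I → Fin nb → Fin na → Set
WantsB {I = I} M b a = mB M b ≡ nothing ⊎ ∃ λ a' → mB M b ≡ just a' × Before a a' (prefB I b)

Blocking : ∀ {na nb} {I : Instance na nb} → Matching I → Fin na → Fin nb → Set
Blocking {I = I} M a b = Edge I a b × mA M a ≢ just b × WantsA M a b × WantsB M b a

Stable : ∀ {na nb} {I : Instance na nb} → Matching I → Set
Stable M = ∀ a b → ¬ Blocking M a b

Perfect : ∀ {na nb} {I : Instance na nb} → Matching I → Set
Perfect M = (∀ a → ∃ λ b → mA M a ≡ just b) × (∀ b → ∃ λ a → mB M b ≡ just a)

SameMatching : ∀ {na nb} {I : Instance na nb} → Matching I → Matching I → Set
SameMatching M M' = ∀ a → mA M a ≡ mA M' a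

countNothing : ∀ {m} {X : Set} → (Fin m → Maybe X) → ℕ
countNothing {zero} f = 0
countNothing {suc m} f with f zero
... | nothing = suc (countNothing (λ i → f (suc i)))
... | just _  = countNothing (λ i → f (suc i))

unmatched : ∀ {na nb} {I : Instance na nb} → Matching I → ℕ
unmatched M = countNothing (mA M) + countNothing (mB M)

data SwapList {A : Set} : List A → List A → Set where
  swap : ∀ x y l → SwapList (x ∷ y ∷ l) (y ∷ x ∷ l)
  cons : ∀ z {l l'} → SwapList l l' → SwapList (z ∷ l) (z ∷ l')

OneSwap : ∀ {na nb} → Instance na nb → Instance na nb → Set
OneSwap I J =
  (Σ _ λ a → SwapList (prefA I a) (prefA J a)
            × (∀ a' → a' ≢ a → prefA J a' ≡ prefA I a')
            × (∀ b → prefB J b ≡ prefB I b))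
  ⊎
  (Σ _ λ b → SwapList (prefB I b) (prefB J b)
            × (∀ b' → b' ≢ b → prefB J b' ≡ prefB I b')
            × (∀ a → prefA J a ≡ prefA I a))

data Swaps {na nb} : ℕ → Instance na nb → Instance na nb → Set where
  done : ∀ {I} → Swaps 0 I I
  step : ∀ {k I J K} → OneSwap I J → Swaps k J K → Swaps (suc k) I K

HasPerfectStable : ∀ {na nb} → Instance na nb → Set
HasPerfectStable I = ∃ λ (M : Matching I) → Stable M × Perfect M

{-# OPTIONS --safe #-}
-- The instance is the path a₀ b₀ a₁ b₁ … aₙ bₙ, in which aⱼ₊₁ and bⱼ are each other's
-- first choice for every j < n.  Mutual first choices are matched in every stable
-- matching, so the unique stable matching is {aⱼ₊₁ bⱼ}, leaving a₀ and bₙ single.  The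
-- only perfect matching of the path is {aᵢ bᵢ}; for it to be stable, for every j < n the
-- list of aⱼ₊₁ or that of bⱼ must change, and a swap changes a single list.
module Submission where

open import Defs
open import Data.Nat using (ℕ; zero; suc; _≤_; _+_; _*_)
import Data.Nat.Properties as ℕ
open import Data.Nat.Tactic.RingSolver using (solve-∀)
open import Data.Fin using (Fin; zero; suc; fromℕ; inject₁; toℕ; _≟_)
import Data.Fin.Properties as Fin
open import Data.Fin.Induction using (<-weakInduction)
open import Data.Fin.Relation.Unary.Top using (View; view; ‵fromℕ; ‵inject₁; view-fromℕ; view-inject₁)
open import Data.List using (List; _∷_; []; length; lookup)
import Data.List.Properties as List
open import Data.List.Membership.Propositional using (_∈_)
open import Data.List.Relation.Binary.Subset.Propositional using (_⊆_)
open import Data.List.Relation.Binary.Subset.Propositional.Properties using (⊆-reflexive; ⊆-trans)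
open import Data.List.Relation.Unary.Any using (here; there; index)
open import Data.List.Relation.Unary.Any.Properties using (lookup-index)
open import Data.List.Relation.Unary.All.Properties using (All¬⇒¬Any)
open import Data.List.Relation.Unary.All using ([]; _∷_)
open import Data.List.Relation.Unary.AllPairs using ([]; _∷_)
open import Data.List.Relation.Unary.Unique.Propositional using (Unique)
open import Data.Maybe using (Maybe; just; nothing)
import Data.Maybe.Properties as Maybe
open import Data.Product using (Σ; ∃; _×_; _,_)
open import Data.Sum using (_⊎_; inj₁; inj₂)
import Data.Sum.Properties as Sum
open import Data.Empty using (⊥-elim)
open import Function using (_∘_)
open import Function.Bundles using (Equivalence; mk⇔)
open import Function.Definitions using (Injective)
open import Relation.Nullary using (¬_; yes; no; contradiction)
open import Relation.Nullary.Decidable using (decidable-stable)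
open import Relation.Binary.PropositionalEquality using (_≡_; _≢_; refl; sym; trans; cong; cong₂; subst)

private
  variable
    A : Set
    x y : A
    l l' : List A
    k na nb : ℕ

inject₁≢suc : (j : Fin k) → inject₁ j ≢ suc j
inject₁≢suc j e = ℕ.1+n≢n (sym (trans (sym (Fin.toℕ-inject₁ j)) (cong toℕ e)))

Before⇒∈ : Before x y l → y ∈ l
Before⇒∈ (here y∈l) = there y∈l
Before⇒∈ (there p)  = there (Before⇒∈ p)

Before-head : Unique (y ∷ l) → Before x y (y ∷ l) → x ≡ y
Before-head _         (here _)  = refl
Before-head (y∉l ∷ _) (there p) = ⊥-elim (All¬⇒¬Any y∉l (Before⇒∈ p))

SwapList⇒⊇ : SwapList l l' → l' ⊆ l
SwapList⇒⊇ (swap x y l) (here e)          = there (here e)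
SwapList⇒⊇ (swap x y l) (there (here e))  = here e
SwapList⇒⊇ (swap x y l) (there (there p)) = there (there p)
SwapList⇒⊇ (cons z s)   (here e)          = here e
SwapList⇒⊇ (cons z s)   (there p)         = there (SwapList⇒⊇ s p)

injection⇒≤length : ∀ {n} {l : List A} (f : Fin n → A) → Injective _≡_ _≡_ f →
                    (∀ i → f i ∈ l) → n ≤ length l
injection⇒≤length {n = n} {l = l} f f-injective f∈l with n ℕ.≤? length l
... | yes n≤ = n≤
... | no n≰ with i , j , i<j , same-index ← Fin.pigeonhole (ℕ.≰⇒> n≰) (index ∘ f∈l) =
  contradiction (f-injective fi≡fj) (Fin.<⇒≢ i<j)
  where
  fi≡fj : f i ≡ f j
  fi≡fj = trans (lookup-index (f∈l i))
                (trans (cong (lookup l) same-index) (sym (lookup-index (f∈l j))))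

cover⇒≤length : ∀ {B C : Set} {n} {f : Fin n → B} {g : Fin n → C} {l : List (B ⊎ C)} →
                Injective _≡_ _≡_ f → Injective _≡_ _≡_ g →
                (∀ i → inj₁ (f i) ∈ l ⊎ inj₂ (g i) ∈ l) → n ≤ length l
cover⇒≤length {B} {C} {n} {f = f} {g = g} {l = l} f-injective g-injective covered =
  injection⇒≤length pick pick-injective (λ i → pick-∈ (covered i))
  where
  pickFrom : ∀ {i} → inj₁ (f i) ∈ l ⊎ inj₂ (g i) ∈ l → B ⊎ C
  pickFrom {i} (inj₁ _) = inj₁ (f i)
  pickFrom {i} (inj₂ _) = inj₂ (g i)

  pick : Fin n → B ⊎ C
  pick i = pickFrom (covered i)

  pick-∈ : ∀ {i} (c : inj₁ (f i) ∈ l ⊎ inj₂ (g i) ∈ l) → pickFrom c ∈ l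
  pick-∈ (inj₁ p) = p
  pick-∈ (inj₂ p) = p

  pickFrom-injective : ∀ {i j} (cᵢ : inj₁ (f i) ∈ l ⊎ inj₂ (g i) ∈ l)
                       (cⱼ : inj₁ (f j) ∈ l ⊎ inj₂ (g j) ∈ l) →
                       pickFrom cᵢ ≡ pickFrom cⱼ → i ≡ j
  pickFrom-injective (inj₁ _) (inj₁ _) e = f-injective (Sum.inj₁-injective e)
  pickFrom-injective (inj₂ _) (inj₂ _) e = g-injective (Sum.inj₂-injective e)
  pickFrom-injective (inj₁ _) (inj₂ _) ()
  pickFrom-injective (inj₂ _) (inj₁ _) ()

  pick-injective : Injective _≡_ _≡_ pick
  pick-injective {i} {j} = pickFrom-injective (covered i) (covered j)

countNothing-just : ∀ {m} (g : Fin m → A) → countNothing (λ i → just (g i)) ≡ 0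
countNothing-just {m = zero}  g = refl
countNothing-just {m = suc m} g = countNothing-just (g ∘ suc)

countNothing-onlyLast : (f : Fin (suc k) → Maybe A) →
                        (∀ j → ∃ λ x → f (inject₁ j) ≡ just x) → f (fromℕ k) ≡ nothing →
                        countNothing f ≡ 1
countNothing-onlyLast {k = zero}  f _ last rewrite last = refl
countNothing-onlyLast {k = suc k} f earlier last with f zero | earlier zero
... | _ | _ , refl = countNothing-onlyLast (f ∘ suc) (earlier ∘ suc) last

module _ {I : Instance na nb} (M : Matching I) where

  matchedA⇒matchedB : ∀ {a b} → mA M a ≡ just b → mB M b ≡ just a
  matchedA⇒matchedB {a} {b} = Equivalence.to (inv M a b)

  matchedB⇒matchedA : ∀ {a b} → mB M b ≡ just a → mA M a ≡ just b
  matchedB⇒matchedA {a} {b} = Equivalence.from (inv M a b)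

  mA-injective : ∀ {a a' b} → mA M a ≡ just b → mA M a' ≡ just b → a ≡ a'
  mA-injective e e' =
    Maybe.just-injective (trans (sym (matchedA⇒matchedB e)) (matchedA⇒matchedB e'))

  firstChoice-wantedA : ∀ {a b l} → prefA I a ≡ b ∷ l → mA M a ≢ just b → WantsA M a b
  firstChoice-wantedA {a} {b} first unmatched with mA M a in e
  ... | nothing = inj₁ refl
  ... | just b' with subst (b' ∈_) first (usesEdges M a b' e)
  ...   | here refl = contradiction refl unmatched
  ...   | there b'∈l = inj₂ (b' , refl , subst (Before b b') (sym first) (here b'∈l))

  firstChoice-wantedB : ∀ {a b l} → prefB I b ≡ a ∷ l → mA M a ≢ just b → WantsB M b a
  firstChoice-wantedB {a} {b} first unmatched with mB M b in e
  ... | nothing = inj₁ refl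
  ... | just a' with subst (a' ∈_) first
                       (Equivalence.to (consistent I a' b) (usesEdges M a' b (matchedB⇒matchedA e)))
  ...   | here refl = contradiction (matchedB⇒matchedA e) unmatched
  ...   | there a'∈l = inj₂ (a' , refl , subst (Before a a') (sym first) (here a'∈l))

  matchedFirstChoice-wantsA⇒≡ : ∀ {a b b' l} → mA M a ≡ just b → prefA I a ≡ b ∷ l →
                                WantsA M a b' → b' ≡ b
  matchedFirstChoice-wantsA⇒≡ matched first (inj₁ single) with () ← trans (sym single) matched
  matchedFirstChoice-wantsA⇒≡ {a} matched first (inj₂ (_ , partner , prefers))
    with refl ← trans (sym partner) matched =
    Before-head (subst Unique first (uniqA I a)) (subst (Before _ _) first prefers)

  matchedFirstChoice-wantsB⇒≡ : ∀ {a a' b l} → mB M b ≡ just a → prefB I b ≡ a ∷ l →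
                                WantsB M b a' → a' ≡ a
  matchedFirstChoice-wantsB⇒≡ matched first (inj₁ single) with () ← trans (sym single) matched
  matchedFirstChoice-wantsB⇒≡ {b = b} matched first (inj₂ (_ , partner , prefers))
    with refl ← trans (sym partner) matched =
    Before-head (subst Unique first (uniqB I b)) (subst (Before _ _) first prefers)

  mutualFirstChoices-matched : Stable M → ∀ {a b la lb} →
                               prefA I a ≡ b ∷ la → prefB I b ≡ a ∷ lb → mA M a ≡ just b
  mutualFirstChoices-matched stable {a} {b} firstA firstB =
    decidable-stable (Maybe.≡-dec _≟_ (mA M a) (just b)) λ unmatched →
      stable a b ( subst (b ∈_) (sym firstA) (here refl) , unmatched
                 , firstChoice-wantedA firstA unmatched , firstChoice-wantedB firstB unmatched )

Vertex : ℕ → ℕ → Set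
Vertex na nb = Fin na ⊎ Fin nb

SamePref : Instance na nb → Instance na nb → Vertex na nb → Set
SamePref I J (inj₁ a) = prefA I a ≡ prefA J a
SamePref I J (inj₂ b) = prefB I b ≡ prefB J b

SamePref-refl : ∀ {I : Instance na nb} v → SamePref I I v
SamePref-refl (inj₁ _) = refl
SamePref-refl (inj₂ _) = refl

SamePref-trans : ∀ {I J K : Instance na nb} v → SamePref I J v → SamePref J K v → SamePref I K v
SamePref-trans (inj₁ _) = trans
SamePref-trans (inj₂ _) = trans

module _ {I J : Instance na nb} where

  OneSwap-⊇ : OneSwap I J → ∀ a → prefA J a ⊆ prefA I a
  OneSwap-⊇ (inj₁ (a₀ , swapped , others , _)) a with a ≟ a₀
  ... | yes refl = SwapList⇒⊇ swapped
  ... | no a≢a₀  = ⊆-reflexive (others a a≢a₀)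
  OneSwap-⊇ (inj₂ (_ , _ , _ , sameA)) a = ⊆-reflexive (sameA a)

  OneSwap-changesOne : OneSwap I J → ∃ λ w → ∀ v → v ≢ w → SamePref I J v
  OneSwap-changesOne (inj₁ (a₀ , _ , others , sameB)) = inj₁ a₀ , λ
    { (inj₁ a) a≢a₀ → sym (others a (a≢a₀ ∘ cong inj₁))
    ; (inj₂ b) _    → sym (sameB b) }
  OneSwap-changesOne (inj₂ (b₀ , _ , others , sameA)) = inj₂ b₀ , λ
    { (inj₁ a) _    → sym (sameA a)
    ; (inj₂ b) b≢b₀ → sym (others b (b≢b₀ ∘ cong inj₂)) }

Swaps-⊇ : ∀ {I J : Instance na nb} → Swaps k I J → ∀ a → prefA J a ⊆ prefA I a
Swaps-⊇ done            a = λ p → p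
Swaps-⊇ {I = I} (step {J = J} one rest) a =
  ⊆-trans (Swaps-⊇ rest a) (OneSwap-⊇ {I = I} {J = J} one a)

Swaps-changedVertices : ∀ {I J : Instance na nb} → Swaps k I J →
                        ∃ λ L → length L ≡ k × (∀ v → ¬ SamePref I J v → v ∈ L)
Swaps-changedVertices done = [] , refl , λ v changed → contradiction (SamePref-refl v) changed
Swaps-changedVertices {I = I} {J = K} (step {J = J} one rest)
  with L , |L|≡k , changed∈L ← Swaps-changedVertices rest
     | w , unchanged ← OneSwap-changesOne {I = I} {J = J} one =
  w ∷ L , cong suc |L|≡k , changed∈w∷L
  where
  changed∈w∷L : ∀ v → ¬ SamePref I K v → v ∈ w ∷ L
  changed∈w∷L v changed with Sum.≡-dec _≟_ _≟_ v w
  ... | yes v≡w = here v≡w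
  ... | no v≢w  = there (changed∈L v (changed ∘ SamePref-trans v (unchanged v v≢w)))

module Path (m : ℕ) where

  -- For n = 0 the shifted matching below is empty and a₀ b₀ blocks it.
  n : ℕ
  n = suc m

  data PathEdge : Fin (suc n) → Fin (suc n) → Set where
    same : ∀ i → PathEdge i i
    prev : ∀ j → PathEdge (suc j) (inject₁ j)

  pathPrefA : Fin (suc n) → List (Fin (suc n))
  pathPrefA zero    = zero ∷ []
  pathPrefA (suc j) = inject₁ j ∷ suc j ∷ []

  pathPrefBᵛ : {b : Fin (suc n)} → View b → List (Fin (suc n))
  pathPrefBᵛ ‵fromℕ        = fromℕ n ∷ []
  pathPrefBᵛ (‵inject₁ j) = suc j ∷ inject₁ j ∷ []

  pathPrefB : Fin (suc n) → List (Fin (suc n))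
  pathPrefB b = pathPrefBᵛ (view b)

  pathPrefB-inject₁ : (j : Fin n) → pathPrefB (inject₁ j) ≡ suc j ∷ inject₁ j ∷ []
  pathPrefB-inject₁ j rewrite view-inject₁ j = refl

  ∈pathPrefA⇒PathEdge : ∀ {a b} → b ∈ pathPrefA a → PathEdge a b
  ∈pathPrefA⇒PathEdge {zero}  (here refl)         = same zero
  ∈pathPrefA⇒PathEdge {suc j} (here refl)         = prev j
  ∈pathPrefA⇒PathEdge {suc j} (there (here refl)) = same (suc j)

  PathEdge⇒∈pathPrefA : ∀ {a b} → PathEdge a b → b ∈ pathPrefA a
  PathEdge⇒∈pathPrefA (same zero)    = here refl
  PathEdge⇒∈pathPrefA (same (suc j)) = there (here refl)
  PathEdge⇒∈pathPrefA (prev j)       = here refl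

  ∈pathPrefBᵛ⇒PathEdge : ∀ {a b} (v : View b) → a ∈ pathPrefBᵛ v → PathEdge a b
  ∈pathPrefBᵛ⇒PathEdge ‵fromℕ        (here refl)         = same _
  ∈pathPrefBᵛ⇒PathEdge (‵inject₁ j) (here refl)         = prev j
  ∈pathPrefBᵛ⇒PathEdge (‵inject₁ j) (there (here refl)) = same _

  ∈pathPrefBᵛ-self : ∀ {b} (v : View b) → b ∈ pathPrefBᵛ v
  ∈pathPrefBᵛ-self ‵fromℕ        = here refl
  ∈pathPrefBᵛ-self (‵inject₁ j) = there (here refl)

  PathEdge⇒∈pathPrefB : ∀ {a b} → PathEdge a b → a ∈ pathPrefB b
  PathEdge⇒∈pathPrefB (same i) = ∈pathPrefBᵛ-self (view i)
  PathEdge⇒∈pathPrefB (prev j) = subst (suc j ∈_) (sym (pathPrefB-inject₁ j)) (here refl)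

  uniqueA : ∀ a → Unique (pathPrefA a)
  uniqueA zero    = [] ∷ []
  uniqueA (suc j) = (inject₁≢suc j ∷ []) ∷ [] ∷ []

  uniqueBᵛ : ∀ {b} (v : View b) → Unique (pathPrefBᵛ v)
  uniqueBᵛ ‵fromℕ        = [] ∷ []
  uniqueBᵛ (‵inject₁ j) = ((inject₁≢suc j ∘ sym) ∷ []) ∷ [] ∷ []

  I : Instance (suc n) (suc n)
  I = record
    { prefA      = pathPrefA
    ; prefB      = pathPrefB
    ; uniqA      = uniqueA
    ; uniqB      = uniqueBᵛ ∘ view
    ; consistent = λ a b → mk⇔ (PathEdge⇒∈pathPrefB ∘ ∈pathPrefA⇒PathEdge)
                               (PathEdge⇒∈pathPrefA ∘ ∈pathPrefBᵛ⇒PathEdge (view b))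
    }

  identity : Matching I
  identity = record
    { mA        = just
    ; mB        = just
    ; inv       = λ _ _ → mk⇔ (cong just ∘ sym ∘ Maybe.just-injective)
                              (cong just ∘ sym ∘ Maybe.just-injective)
    ; usesEdges = λ { a .a refl → PathEdge⇒∈pathPrefA (same a) }
    }

  identity-perfect : Perfect identity
  identity-perfect = (λ a → a , refl) , (λ b → b , refl)

  shiftA : Fin (suc n) → Maybe (Fin (suc n))
  shiftA zero    = nothing
  shiftA (suc j) = just (inject₁ j)

  shiftBᵛ : {b : Fin (suc n)} → View b → Maybe (Fin (suc n))
  shiftBᵛ ‵fromℕ        = nothing
  shiftBᵛ (‵inject₁ j) = just (suc j)

  shiftB-inject₁ : (j : Fin n) → shiftBᵛ (view (inject₁ j)) ≡ just (suc j)
  shiftB-inject₁ j rewrite view-inject₁ j = refl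

  shiftB⇒shiftA : ∀ {a b} (v : View b) → shiftBᵛ v ≡ just a → shiftA a ≡ just b
  shiftB⇒shiftA (‵inject₁ j) refl = refl

  shiftA⇒shiftB : ∀ {a b} → shiftA a ≡ just b → shiftBᵛ (view b) ≡ just a
  shiftA⇒shiftB {suc j} refl = shiftB-inject₁ j

  shifted : Matching I
  shifted = record
    { mA        = shiftA
    ; mB        = shiftBᵛ ∘ view
    ; inv       = λ a b → mk⇔ shiftA⇒shiftB (shiftB⇒shiftA (view b))
    ; usesEdges = λ { (suc j) _ refl → PathEdge⇒∈pathPrefA (prev j) }
    }

  shifted-stable : Stable shifted
  shifted-stable (suc j) b (_ , unmatched , wantsA , _) =
    unmatched (cong just (sym (matchedFirstChoice-wantsA⇒≡ shifted refl refl wantsA)))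
  shifted-stable zero .zero (here refl , _ , _ , wantsB)
    with () ← matchedFirstChoice-wantsB⇒≡ shifted {b = zero} (shiftB-inject₁ zero) (pathPrefB-inject₁ zero) wantsB

  shifted-unique : ∀ M → Stable M → SameMatching M shifted
  shifted-unique M stable (suc j) = mutualFirstChoices-matched M stable refl (pathPrefB-inject₁ j)
  shifted-unique M stable zero with mA M zero in e
  ... | nothing = refl
  ... | just b with here refl ← usesEdges M zero b e
    with () ← mA-injective M e (shifted-unique M stable (suc zero))

  shifted-unmatched : unmatched shifted ≡ 2
  shifted-unmatched =
    cong suc (cong₂ _+_ (countNothing-just {m = n} inject₁)
                        (countNothing-onlyLast (shiftBᵛ ∘ view) (λ j → suc j , shiftB-inject₁ j)
                                               (cong shiftBᵛ (view-fromℕ n))))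

  module _ {k} {J : Instance (suc n) (suc n)} (I↝J : Swaps k I J) where

    pathEdge : ∀ {a b} → Edge J a b → PathEdge a b
    pathEdge = ∈pathPrefA⇒PathEdge ∘ Swaps-⊇ I↝J _

    perfect⇒identity : (P : Matching J) → Perfect P → ∀ i → mA P i ≡ just i
    perfect⇒identity P (coversA , _) = <-weakInduction (λ i → mA P i ≡ just i) matched₀ matchedSuc
      where
      matched₀ : mA P zero ≡ just zero
      matched₀ with b , e ← coversA zero with same _ ← pathEdge (usesEdges P zero b e) = e

      matchedSuc : ∀ j → mA P (inject₁ j) ≡ just (inject₁ j) → mA P (suc j) ≡ just (suc j)
      matchedSuc j ih with b , e ← coversA (suc j) with pathEdge (usesEdges P (suc j) b e)
      ... | same _ = e
      ... | prev _ = contradiction (mA-injective P ih e) (inject₁≢suc j)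

    unchanged-blocks : (P : Matching J) → Stable P → Perfect P → ∀ j →
                       SamePref I J (inj₁ (suc j)) → ¬ SamePref I J (inj₂ (inject₁ j))
    unchanged-blocks P stable perfect j sameA sameB =
      inject₁≢suc j (Maybe.just-injective (trans (sym matchedFirst) (perfect⇒identity P perfect (suc j))))
      where
      matchedFirst : mA P (suc j) ≡ just (inject₁ j)
      matchedFirst =
        mutualFirstChoices-matched P stable (sym sameA) (trans (sym sameB) (pathPrefB-inject₁ j))

    swaps-lowerBound : HasPerfectStable J → n ≤ k
    swaps-lowerBound (P , stable , perfect)
      with L , |L|≡k , changed∈L ← Swaps-changedVertices I↝J =
      subst (n ≤_) |L|≡k (cover⇒≤length Fin.suc-injective Fin.inject₁-injective changedAt)
      where
      changedAt : ∀ j → inj₁ (suc j) ∈ L ⊎ inj₂ (inject₁ j) ∈ L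
      changedAt j with List.≡-dec _≟_ (prefA I (suc j)) (prefA J (suc j))
      ... | no  changedA = inj₁ (changed∈L _ changedA)
      ... | yes sameA    = inj₂ (changed∈L _ (unchanged-blocks P stable perfect j sameA))

vertexCount : ∀ m → suc (suc m) + suc (suc m) ≡ 2 * suc m + 2
vertexCount = solve-∀

proposition2 : (n : ℕ) → 1 ≤ n →
    Σ ℕ λ na → Σ ℕ λ nb → na + nb ≡ 2 * n + 2 ×
    Σ (Instance na nb) λ I →
      (∃ λ (P : Matching I) → Perfect P) ×
      (Σ (Matching I) λ M →
        Stable M ×
        (∀ (M' : Matching I) → Stable M' → SameMatching M' M) ×
        unmatched M ≡ 2) ×
      (∀ (k : ℕ) (J : Instance na nb) → Swaps k I J → HasPerfectStable J → n ≤ k)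
proposition2 (suc m) _ =
  suc (suc m) , suc (suc m) , vertexCount m , I , (identity , identity-perfect) ,
  (shifted , shifted-stable , shifted-unique , shifted-unmatched) ,
  λ _ _ → swaps-lowerBound
  where open Path m
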